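{- For a positive integer $d$ let \[ \alpha(d) = \prod_{p\mid d}\left(1-\frac{1}{p-1}\right),\qquad \alpha_1(d) = \sum_{p\mid d} \frac{1}{p-1}. \] If $K \geq 1$ and $\omega(d) \leq K$, then \[ |1-\alpha(d)-\alpha_1(d)| \leq \frac{4e^K}{p(d)^2}. \]
   Context: $\omega(d)$ is the number of distinct prime factors of $d$, $p(d)$ is the smallest prime factor of $d$ (with $p(1)=\infty$), and $p$ ranges over primes.
   Formalization: The parameter K ranges only over the rationals. -}

module Defs where

open import Data.Nat as ℕ using (ℕ; zero; suc; _∸_)
open import Data.Nat.Divisibility using (_∣_; _∣?_)
open import Data.Nat.Primality using (Prime; prime?)
open import Data.Integer using (+_)
open import Data.Rational using (ℚ; _/_; 0ℚ; 1ℚ; _+_; _*_; _-_; ∣_∣; _≤_; _<_)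
open import Data.List using (List; []; _∷_; filter; upTo; length; foldr)
open import Data.Maybe using (Maybe; just; nothing)
open import Data.Product using (∃)
open import Relation.Nullary.Decidable using (_×-dec_)

toℚ : ℕ → ℚ
toℚ n = + n / 1

-- 1/n as a rational (only used with n ≥ 1; 1/0 is set to 0)
inv : ℕ → ℚ
inv zero    = 0ℚ
inv (suc n) = + 1 / suc n

primeDivisors : ℕ → List ℕ
primeDivisors d = filter (λ p → prime? p ×-dec p ∣? d) (upTo (suc d))

ω : ℕ → ℕ
ω d = length (primeDivisors d)

-- p(d): smallest prime factor; nothing encodes p(1) = ∞
spf : ℕ → Maybe ℕ
spf d with primeDivisors d
... | []    = nothing
... | p ∷ _ = just p

-- 1 / p(d)^2, with 1/∞^2 = 0
invSqSpf : ℕ → ℚ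
invSqSpf d with spf d
... | nothing = 0ℚ
... | just p  = inv (p ℕ.* p)

α : ℕ → ℚ
α d = foldr (λ p acc → (1ℚ - inv (p ∸ 1)) * acc) 1ℚ (primeDivisors d)

α₁ : ℕ → ℚ
α₁ d = foldr (λ p acc → inv (p ∸ 1) + acc) 0ℚ (primeDivisors d)

expTerm : ℚ → ℕ → ℚ
expTerm K zero    = 1ℚ
expTerm K (suc n) = expTerm K n * K * inv (suc n)

expPartial : ℚ → ℕ → ℚ
expPartial K zero    = 0ℚ
expPartial K (suc N) = expPartial K N + expTerm K N

-- x ≤ c · e^K, where e^K = sup_N S_N(K) (K ≥ 0, c ≥ 0):
-- every rational below x is bounded by c · S_N(K) for some N.
_≤_·exp_ : ℚ → ℚ → ℚ → Set
x ≤ c ·exp K = ∀ r → r < x → ∃ λ N → r ≤ c * expPartial K N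

-- With y_p = 1/(p-1) ∈ [0,1] for the primes p ∣ d, α = ∏ (1 - y_p) and α₁ = ∑ y_p. By the
-- Weierstrass product inequality ∏ (1 - y) ≥ 1 - ∑ y the quantity G = α + α₁ - 1 is nonnegative,
-- and adding one factor raises G by y (1 - ∏ (1 - y)) ≤ y ∑ y, whence 2G ≤ (∑ y)². Every y_p is at
-- most 1/(p(d) - 1) ≤ 2/p(d), so (∑ y)² ≤ 4ω(d)²/p(d)² ≤ 4K²/p(d)², and K²/2 ≤ 1 + K + K²/2 ≤ e^K.

module Submission where

open import Defs
open import Data.Nat using (ℕ)
open import Data.Rational using (ℚ; 1ℚ; _-_; _*_; ∣_∣; _≤_)
open import Data.Integer using (+_)
open import Data.Rational using (_/_)

open import Level using (0ℓ)
open import Data.Nat as ℕ using (zero; suc; _∸_; NonZero; z≤n; s≤s)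
import Data.Nat.Properties as ℕ
import Data.Nat.Tactic.RingSolver as ℕ-Solver
open import Data.Nat.Primality using (Prime; prime?; prime⇒nonTrivial)
open import Data.Nat.Divisibility using (_∣?_)
import Data.Integer as ℤ
import Data.Integer.Properties as ℤ
import Data.Integer.Tactic.RingSolver as ℤ-Solver
open import Data.Rational using (0ℚ; _+_; -_; toℚᵘ; nonNegative)
open import Data.Rational.Properties
  using ( _≟_; ≤-refl; ≤-reflexive; ≤-trans; <⇒≤; <-≤-trans; ≮⇒≥; <-irrefl
        ; +-mono-≤; +-monoˡ-≤; +-monoʳ-≤; +-mono-<; +-inverseʳ; +-identityʳ
        ; neg-antimono-≤; *-zeroˡ; *-identityʳ; *-distribˡ-+
        ; *-monoˡ-≤-nonNeg; *-monoʳ-≤-nonNeg; nonNeg*nonNeg⇒nonNeg; nonNegative⁻¹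
        ; 0≤p⇒∣p∣≡p; ∣-p∣≡∣p∣; +-*-commutativeRing
        ; toℚᵘ-injective; toℚᵘ-cancel-≤; toℚᵘ-fromℚᵘ; toℚᵘ-homo-+; toℚᵘ-homo-*
        ; module ≤-Reasoning )
import Data.Rational.Unnormalised as ℚᵘ
import Data.Rational.Unnormalised.Properties as ℚᵘ
open import Data.List using (List; []; _∷_; foldr; length; upTo)
open import Data.List.Relation.Unary.All as All using (All; []; _∷_)
import Data.List.Relation.Unary.All.Properties as All
open import Data.List.Relation.Unary.AllPairs using (AllPairs; _∷_)
import Data.List.Relation.Unary.AllPairs.Properties as AllPairs
open import Data.Product using (_×_; _,_; proj₁; proj₂)
open import Function using (id)
open import Relation.Nullary.Decidable using (_×-dec_; dec⇒maybe)
open import Relation.Binary.PropositionalEquality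
  using (_≡_; refl; sym; cong; subst; subst₂; module ≡-Reasoning)
open import Tactic.RingSolver using (solve-∀)
open import Tactic.RingSolver.Core.AlmostCommutativeRing
  using (AlmostCommutativeRing; fromCommutativeRing)

private variable
  A : Set
  f : A → ℚ
  xs : List A
  p q r s : ℚ

ℚ-ring : AlmostCommutativeRing 0ℓ 0ℓ
ℚ-ring = fromCommutativeRing +-*-commutativeRing (λ q → dec⇒maybe (0ℚ ≟ q))

0≤q-p : p ≤ q → 0ℚ ≤ q - p
0≤q-p {p} {q} p≤q = subst (_≤ q - p) (+-inverseʳ p) (+-monoˡ-≤ (- p) p≤q)

p-q≤p : 0ℚ ≤ q → p - q ≤ p
p-q≤p {q} {p} 0≤q = subst (p - q ≤_) (+-identityʳ p) (+-monoʳ-≤ p (neg-antimono-≤ 0≤q))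

p≤p+q : 0ℚ ≤ q → p ≤ p + q
p≤p+q {q} {p} 0≤q = subst (_≤ p + q) (+-identityʳ p) (+-monoʳ-≤ p 0≤q)

0≤p*q : 0ℚ ≤ p → 0ℚ ≤ q → 0ℚ ≤ p * q
0≤p*q {p} {q} 0≤p 0≤q =
  nonNegative⁻¹ (p * q) {{nonNeg*nonNeg⇒nonNeg p {{nonNegative 0≤p}} q {{nonNegative 0≤q}}}}

*-mono-≤-nonNeg : 0ℚ ≤ p → 0ℚ ≤ r → p ≤ q → r ≤ s → p * r ≤ q * s
*-mono-≤-nonNeg {p} {r} {q} {s} 0≤p 0≤r p≤q r≤s = ≤-trans
  (*-monoʳ-≤-nonNeg r {{nonNegative 0≤r}} p≤q)
  (*-monoˡ-≤-nonNeg q {{nonNegative (≤-trans 0≤p p≤q)}} r≤s)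

p+p≤q+q⇒p≤q : p + p ≤ q + q → p ≤ q
p+p≤q+q⇒p≤q p+p≤q+q = ≮⇒≥ (λ q<p → <-irrefl refl (<-≤-trans (+-mono-< q<p q<p) p+p≤q+q))

toℚᵘ-/ : ∀ a k → toℚᵘ (+ a / suc k) ℚᵘ.≃ ℚᵘ.mkℚᵘ (+ a) k
toℚᵘ-/ a k = toℚᵘ-fromℚᵘ (ℚᵘ.mkℚᵘ (+ a) k)

/≤/ : ∀ a b c d → a ℕ.* suc d ℕ.≤ c ℕ.* suc b → + a / suc b ≤ + c / suc d
/≤/ a b c d ad≤cb = toℚᵘ-cancel-≤
  (ℚᵘ.≤-respˡ-≃ (ℚᵘ.≃-sym (toℚᵘ-/ a b)) (ℚᵘ.≤-respʳ-≃ (ℚᵘ.≃-sym (toℚᵘ-/ c d))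
    (ℚᵘ.*≤* (subst₂ ℤ._≤_ (ℤ.pos-* a (suc d)) (ℤ.pos-* c (suc b)) (ℤ.+≤+ ad≤cb)))))

/*/ : ∀ a b c d → (+ a / suc b) * (+ c / suc d) ≡ + (a ℕ.* c) / (suc b ℕ.* suc d)
/*/ a b c d = toℚᵘ-injective (begin
  toℚᵘ ((+ a / suc b) * (+ c / suc d))             ≈⟨ toℚᵘ-homo-* (+ a / suc b) (+ c / suc d) ⟩
  toℚᵘ (+ a / suc b) ℚᵘ.* toℚᵘ (+ c / suc d)       ≈⟨ ℚᵘ.*-cong (toℚᵘ-/ a b) (toℚᵘ-/ c d) ⟩
  ℚᵘ.mkℚᵘ (+ a ℤ.* + c) (d ℕ.+ b ℕ.* suc d)        ≡⟨ cong (λ i → ℚᵘ.mkℚᵘ i _) (ℤ.pos-* a c) ⟨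
  ℚᵘ.mkℚᵘ (+ (a ℕ.* c)) (d ℕ.+ b ℕ.* suc d)        ≈⟨ toℚᵘ-/ (a ℕ.* c) (d ℕ.+ b ℕ.* suc d) ⟨
  toℚᵘ (+ (a ℕ.* c) / (suc b ℕ.* suc d))           ∎)
  where open ℚᵘ.≃-Reasoning

0≤toℚ : ∀ n → 0ℚ ≤ toℚ n
0≤toℚ n = /≤/ 0 0 n 0 z≤n

toℚ-suc : ∀ n → toℚ (suc n) ≡ toℚ n + 1ℚ
toℚ-suc n = toℚᵘ-injective (begin
  toℚᵘ (toℚ (suc n))                     ≈⟨ toℚᵘ-/ (suc n) 0 ⟩
  ℚᵘ.mkℚᵘ (+ suc n) 0                    ≈⟨ ℚᵘ.*≡* (shift (+ n)) ⟩
  ℚᵘ.mkℚᵘ (+ n) 0 ℚᵘ.+ ℚᵘ.mkℚᵘ (+ 1) 0   ≈⟨ ℚᵘ.+-cong (toℚᵘ-/ n 0) ℚᵘ.≃-refl ⟨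
  toℚᵘ (toℚ n) ℚᵘ.+ toℚᵘ 1ℚ              ≈⟨ toℚᵘ-homo-+ (toℚ n) 1ℚ ⟨
  toℚᵘ (toℚ n + 1ℚ)                      ∎)
  where
  open ℚᵘ.≃-Reasoning
  shift : ∀ i → (+ 1 ℤ.+ i) ℤ.* + 1 ≡ (i ℤ.* + 1 ℤ.+ + 1 ℤ.* + 1) ℤ.* + 1
  shift = ℤ-Solver.solve-∀

0≤inv : ∀ n → 0ℚ ≤ inv n
0≤inv zero    = ≤-refl
0≤inv (suc n) = /≤/ 0 0 1 n z≤n

inv-antitone : ∀ {m n} .{{_ : NonZero m}} → m ℕ.≤ n → inv n ≤ inv m
inv-antitone {suc m} {suc n} m≤n = /≤/ 1 n 1 m (ℕ.*-monoʳ-≤ 1 m≤n)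

inv≤1 : ∀ n → inv n ≤ 1ℚ
inv≤1 zero    = nonNegative⁻¹ 1ℚ
inv≤1 (suc n) = inv-antitone {1} {suc n} (s≤s z≤n)

∏[1-_] : (A → ℚ) → List A → ℚ
∏[1- f ] = foldr (λ a acc → (1ℚ - f a) * acc) 1ℚ

∑[_] : (A → ℚ) → List A → ℚ
∑[ f ] = foldr (λ a acc → f a + acc) 0ℚ

_∈[0,1] : ℚ → Set
q ∈[0,1] = 0ℚ ≤ q × q ≤ 1ℚ

0≤∏[1-] : All (λ a → f a ≤ 1ℚ) xs → 0ℚ ≤ ∏[1- f ] xs
0≤∏[1-] []          = nonNegative⁻¹ 1ℚ
0≤∏[1-] (fa≤1 ∷ hs) = 0≤p*q (0≤q-p fa≤1) (0≤∏[1-] hs)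

∏[1-]≤1 : All (λ a → f a ∈[0,1]) xs → ∏[1- f ] xs ≤ 1ℚ
∏[1-]≤1 [] = ≤-refl
∏[1-]≤1 ((0≤fa , fa≤1) ∷ hs) = *-mono-≤-nonNeg
  (0≤q-p fa≤1) (0≤∏[1-] (All.map proj₂ hs)) (p-q≤p 0≤fa) (∏[1-]≤1 hs)

0≤∑ : All (λ a → 0ℚ ≤ f a) xs → 0ℚ ≤ ∑[ f ] xs
0≤∑ []          = ≤-refl
0≤∑ (0≤fa ∷ hs) = +-mono-≤ 0≤fa (0≤∑ hs)

∑≤length*bound : All (λ a → f a ≤ q) xs → ∑[ f ] xs ≤ toℚ (length xs) * q
∑≤length*bound {q = q} [] = ≤-reflexive (sym (*-zeroˡ q))
∑≤length*bound {f = f} {q = q} {xs = a ∷ as} (fa≤q ∷ hs) = begin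
  f a + ∑[ f ] as                ≤⟨ +-mono-≤ fa≤q (∑≤length*bound hs) ⟩
  q + toℚ (length as) * q        ≡⟨ step q (toℚ (length as)) ⟩
  (toℚ (length as) + 1ℚ) * q     ≡⟨ cong (_* q) (toℚ-suc (length as)) ⟨
  toℚ (length (a ∷ as)) * q      ∎
  where
  open ≤-Reasoning
  step : ∀ q m → q + m * q ≡ (m + 1ℚ) * q
  step = solve-∀ ℚ-ring

1-∏[1-]≤∑ : All (λ a → f a ∈[0,1]) xs → 1ℚ - ∏[1- f ] xs ≤ ∑[ f ] xs
1-∏[1-]≤∑ [] = ≤-refl
1-∏[1-]≤∑ {f = f} {xs = a ∷ as} ((0≤fa , _) ∷ hs) = begin
  1ℚ - (1ℚ - f a) * P              ≡⟨ expand (f a) P ⟩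
  (1ℚ - P) + f a * P               ≤⟨ +-mono-≤ (1-∏[1-]≤∑ hs) faP≤fa ⟩
  ∑[ f ] as + f a * 1ℚ             ≡⟨ collect (f a) (∑[ f ] as) ⟩
  f a + ∑[ f ] as                  ∎
  where
  open ≤-Reasoning
  P = ∏[1- f ] as
  faP≤fa : f a * P ≤ f a * 1ℚ
  faP≤fa = *-monoˡ-≤-nonNeg (f a) {{nonNegative 0≤fa}} (∏[1-]≤1 hs)
  expand : ∀ y P → 1ℚ - (1ℚ - y) * P ≡ (1ℚ - P) + y * P
  expand = solve-∀ ℚ-ring
  collect : ∀ y S → S + y * 1ℚ ≡ y + S
  collect = solve-∀ ℚ-ring

weierstrassGap : (A → ℚ) → List A → ℚ
weierstrassGap f xs = ∑[ f ] xs - (1ℚ - ∏[1- f ] xs)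

weierstrassGap-∷ : ∀ (f : A → ℚ) a xs →
  weierstrassGap f (a ∷ xs) ≡ weierstrassGap f xs + f a * (1ℚ - ∏[1- f ] xs)
weierstrassGap-∷ f a xs = recurrence (f a) (∏[1- f ] xs) (∑[ f ] xs)
  where
  recurrence : ∀ y P S → (y + S) - (1ℚ - (1ℚ - y) * P) ≡ (S - (1ℚ - P)) + y * (1ℚ - P)
  recurrence = solve-∀ ℚ-ring

∣1-∏[1-]-∑∣≡weierstrassGap : All (λ a → f a ∈[0,1]) xs →
  ∣ 1ℚ - ∏[1- f ] xs - ∑[ f ] xs ∣ ≡ weierstrassGap f xs
∣1-∏[1-]-∑∣≡weierstrassGap {f = f} {xs = xs} hs = begin
  ∣ 1ℚ - ∏[1- f ] xs - ∑[ f ] xs ∣  ≡⟨ cong ∣_∣ (negate (∏[1- f ] xs) (∑[ f ] xs)) ⟩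
  ∣ - weierstrassGap f xs ∣         ≡⟨ ∣-p∣≡∣p∣ (weierstrassGap f xs) ⟩
  ∣ weierstrassGap f xs ∣           ≡⟨ 0≤p⇒∣p∣≡p (0≤q-p (1-∏[1-]≤∑ hs)) ⟩
  weierstrassGap f xs               ∎
  where
  open ≡-Reasoning
  negate : ∀ P S → 1ℚ - P - S ≡ - (S - (1ℚ - P))
  negate = solve-∀ ℚ-ring

weierstrassGap-doubled≤∑² : All (λ a → f a ∈[0,1]) xs →
  weierstrassGap f xs + weierstrassGap f xs ≤ ∑[ f ] xs * ∑[ f ] xs
weierstrassGap-doubled≤∑² [] = ≤-refl
weierstrassGap-doubled≤∑² {f = f} {xs = a ∷ as} ((0≤fa , _) ∷ hs) = begin
  G′ + G′                              ≡⟨ cong (λ g → g + g) (weierstrassGap-∷ f a as) ⟩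
  (G + y * D) + (G + y * D)            ≡⟨ regroup G (y * D) ⟩
  (G + G) + (y * D + y * D)            ≤⟨ +-mono-≤ (weierstrassGap-doubled≤∑² hs) (+-mono-≤ yD≤yS yD≤yS) ⟩
  S * S + (y * S + y * S)              ≤⟨ p≤p+q (0≤p*q 0≤fa 0≤fa) ⟩
  S * S + (y * S + y * S) + y * y      ≡⟨ square y S ⟩
  (y + S) * (y + S)                    ∎
  where
  open ≤-Reasoning
  y = f a
  S = ∑[ f ] as
  D = 1ℚ - ∏[1- f ] as
  G = weierstrassGap f as
  G′ = weierstrassGap f (a ∷ as)
  yD≤yS : y * D ≤ y * S
  yD≤yS = *-monoˡ-≤-nonNeg y {{nonNegative 0≤fa}} (1-∏[1-]≤∑ hs)
  regroup : ∀ g t → (g + t) + (g + t) ≡ (g + g) + (t + t)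
  regroup = solve-∀ ℚ-ring
  square : ∀ y S → S * S + (y * S + y * S) + y * y ≡ (y + S) * (y + S)
  square = solve-∀ ℚ-ring

invPred : ℕ → ℚ
invPred p = inv (p ∸ 1)

invPred∈[0,1] : ∀ p → invPred p ∈[0,1]
invPred∈[0,1] p = 0≤inv (p ∸ 1) , inv≤1 (p ∸ 1)

invPred-antitone : ∀ {m n} → 2 ℕ.≤ m → m ℕ.≤ n → invPred n ≤ invPred m
invPred-antitone (s≤s (s≤s _)) m≤n = inv-antitone (ℕ.∸-monoˡ-≤ 1 m≤n)

invPred²≤4*inv² : ∀ {m} → 2 ℕ.≤ m → invPred m * invPred m ≤ toℚ 4 * inv (m ℕ.* m)
invPred²≤4*inv² {suc (suc k)} (s≤s (s≤s _)) = begin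
  inv (suc k) * inv (suc k)      ≡⟨ /*/ 1 k 1 k ⟩
  + 1 / (suc k ℕ.* suc k)        ≤⟨ /≤/ 1 (k ℕ.+ k ℕ.* suc k) 4 (n ℕ.+ 0) cross ⟩
  + 4 / (1 ℕ.* (k+2 ℕ.* k+2))    ≡⟨ /*/ 4 0 1 n ⟨
  toℚ 4 * inv (k+2 ℕ.* k+2)      ∎
  where
  open ≤-Reasoning
  k+2 = suc (suc k)
  -- k+2 ℕ.* k+2 reduces to suc n
  n = suc k ℕ.+ suc k ℕ.* k+2
  expand : ∀ k → 4 ℕ.* (suc k ℕ.* suc k) ≡
                 1 ℕ.* (1 ℕ.* ((2 ℕ.+ k) ℕ.* (2 ℕ.+ k))) ℕ.+ (3 ℕ.* k ℕ.* k ℕ.+ 4 ℕ.* k)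
  expand = ℕ-Solver.solve-∀
  cross : 1 ℕ.* (1 ℕ.* (k+2 ℕ.* k+2)) ℕ.≤ 4 ℕ.* (suc k ℕ.* suc k)
  cross = subst (1 ℕ.* (1 ℕ.* (k+2 ℕ.* k+2)) ℕ.≤_) (sym (expand k))
    (ℕ.m≤m+n (1 ℕ.* (1 ℕ.* (k+2 ℕ.* k+2))) (3 ℕ.* k ℕ.* k ℕ.+ 4 ℕ.* k))

K²≤2*expPartial3 : ∀ {K} → 0ℚ ≤ K → K * K ≤ expPartial K 3 + expPartial K 3
K²≤2*expPartial3 {K} 0≤K = begin
  K * K                                       ≡⟨ *-identityʳ (K * K) ⟨
  K * K * 1ℚ                                  ≤⟨ p≤p+q (+-mono-≤ 0≤2 (0≤p*q (+-mono-≤ 0≤K 0≤K) 0≤1)) ⟩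
  K * K * 1ℚ + ((1ℚ + 1ℚ) + (K + K) * 1ℚ)     ≡⟨ twice-expPartial3 K (inv 1) (inv 2) ⟩
  expPartial K 3 + expPartial K 3             ∎
  where
  open ≤-Reasoning
  0≤1 = nonNegative⁻¹ 1ℚ
  0≤2 = nonNegative⁻¹ (1ℚ + 1ℚ)
  -- The solver cannot see that inv 1 and inv 1 * (inv 2 + inv 2) are 1ℚ, so the identity
  -- abstracts them; the instance then holds by computation.
  twice-expPartial3 : ∀ K o h →
    K * K * (o * (h + h)) + ((1ℚ + 1ℚ) + (K + K) * o) ≡
    (((0ℚ + 1ℚ) + 1ℚ * K * o) + 1ℚ * K * o * K * h) + (((0ℚ + 1ℚ) + 1ℚ * K * o) + 1ℚ * K * o * K * h)
  twice-expPartial3 = solve-∀ ℚ-ring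

weierstrassGap-invPred≤ : ∀ {p ps K} → 2 ℕ.≤ p → All (p ℕ.≤_) ps →
  0ℚ ≤ K → toℚ (length (p ∷ ps)) ≤ K →
  weierstrassGap invPred (p ∷ ps) ≤ (toℚ 4 * inv (p ℕ.* p)) * expPartial K 3
weierstrassGap-invPred≤ {p} {ps} {K} 2≤p p≤ps 0≤K length≤K = p+p≤q+q⇒p≤q (begin
  G + G                ≤⟨ weierstrassGap-doubled≤∑² unit ⟩
  S * S                ≤⟨ *-mono-≤-nonNeg 0≤S 0≤S S≤Kx S≤Kx ⟩
  (K * x) * (K * x)    ≡⟨ rearrange K x ⟩
  (x * x) * (K * K)    ≤⟨ *-monoʳ-≤-nonNeg (K * K) {{nonNegative 0≤K²}} (invPred²≤4*inv² 2≤p) ⟩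
  c * (K * K)          ≤⟨ *-monoˡ-≤-nonNeg c {{nonNegative 0≤c}} (K²≤2*expPartial3 0≤K) ⟩
  c * (E + E)          ≡⟨ *-distribˡ-+ c E E ⟩
  c * E + c * E        ∎)
  where
  open ≤-Reasoning
  qs = p ∷ ps
  x = invPred p
  c = toℚ 4 * inv (p ℕ.* p)
  E = expPartial K 3
  G = weierstrassGap invPred qs
  S = ∑[ invPred ] qs
  unit : All (λ q → invPred q ∈[0,1]) qs
  unit = All.universal invPred∈[0,1] qs
  0≤S : 0ℚ ≤ S
  0≤S = 0≤∑ (All.map proj₁ unit)
  S≤Kx : S ≤ K * x
  S≤Kx = ≤-trans
    (∑≤length*bound {f = invPred} {q = x} {xs = qs} (≤-refl ∷ All.map (invPred-antitone 2≤p) p≤ps))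
    (*-monoʳ-≤-nonNeg x {{nonNegative (0≤inv (p ∸ 1))}} length≤K)
  0≤K² : 0ℚ ≤ K * K
  0≤K² = 0≤p*q 0≤K 0≤K
  0≤c : 0ℚ ≤ c
  0≤c = 0≤p*q (0≤toℚ 4) (0≤inv (p ℕ.* p))
  rearrange : ∀ K x → (K * x) * (K * x) ≡ (x * x) * (K * K)
  rearrange = solve-∀ ℚ-ring

primeDivisors-sorted : ∀ d → AllPairs ℕ._≤_ (primeDivisors d)
primeDivisors-sorted d = AllPairs.filter⁺ (λ p → prime? p ×-dec p ∣? d)
  (AllPairs.applyUpTo⁺₁ id (suc d) (λ i<j _ → ℕ.<⇒≤ i<j))

primeDivisors-prime : ∀ d → All Prime (primeDivisors d)
primeDivisors-prime d = All.map proj₁ (All.all-filter (λ p → prime? p ×-dec p ∣? d) (upTo (suc d)))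

≤*expPartial⇒≤·exp : ∀ {x c K} N → x ≤ c * expPartial K N → x ≤ c ·exp K
≤*expPartial⇒≤·exp N x≤cS r r<x = N , <⇒≤ (<-≤-trans r<x x≤cS)

lemma3p3 : (K : ℚ) (d : ℕ) → 1 Data.Nat.≤ d → 1ℚ ≤ K → toℚ (ω d) ≤ K →
    ∣ 1ℚ - α d - α₁ d ∣ ≤ ((+ 4 / 1) * invSqSpf d) ·exp K
lemma3p3 K d _ 1≤K ω≤K with primeDivisors d | primeDivisors-sorted d | primeDivisors-prime d
... | []     | _        | _           = ≤*expPartial⇒≤·exp {c = toℚ 4 * 0ℚ} {K = K} 0 ≤-refl
... | p ∷ ps | p≤ps ∷ _ | p-prime ∷ _ = ≤*expPartial⇒≤·exp {c = c} {K = K} 3 (begin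
  ∣ 1ℚ - ∏[1- invPred ] qs - ∑[ invPred ] qs ∣  ≡⟨ ∣1-∏[1-]-∑∣≡weierstrassGap (All.universal invPred∈[0,1] qs) ⟩
  weierstrassGap invPred qs                      ≤⟨ weierstrassGap-invPred≤ 2≤p p≤ps 0≤K ω≤K ⟩
  c * expPartial K 3                             ∎)
  where
  open ≤-Reasoning
  qs = p ∷ ps
  c = toℚ 4 * inv (p ℕ.* p)
  2≤p = ℕ.nonTrivial⇒n>1 p {{prime⇒nonTrivial p-prime}}
  0≤K = ≤-trans (nonNegative⁻¹ 1ℚ) 1≤K
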